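{- Let $\mathcal I$ be an instance of 3-\textsc{sat} with variables $x_1,\dots,x_p$ and clauses $c_1,\dots,c_q$, each clause consisting of exactly three literals. Let $G$ be the graph defined as follows. $V(G)=L\cup C\cup\{a_1,a_2,u_1,u_2,b,y,z\}$, where $L$ consists of $2p$ literal vertices, one for each literal $x_i$ and $\overline{x_i}$ ($1\le i\le p$), and $C$ consists of $q$ clause vertices, one for each clause. The edges are: every two literal vertices are adjacent except that $x_i$ and $\overline{x_i}$ are nonadjacent for each $i$; $C$ is an independent set; a literal vertex $\ell$ and a clause vertex $c$ are adjacent iff the literal $\ell$ does not occur in the clause $c$; and additionally the edges $a_1a_2$, $u_1u_2$, $yz$, all edges between $\{b,z\}$ and $L$, and all edges between $\{a_2,u_1,u_2,y\}$ and $L\cup C$; there are no other edges. Then $G$ is weakly chordal.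
   Context: A graph $G$ is weakly chordal if neither $G$ nor its complement contains an induced cycle on five or more vertices. -}

module Defs where

open import Data.Nat using (ℕ; suc; _+_; _%_)
open import Data.Fin using (Fin; toℕ)
open import Data.Bool using (Bool; true; false)
open import Data.Product using (Σ; _×_; _,_; proj₁)
open import Data.Sum using (_⊎_)
open import Data.Empty using (⊥)
import Data.Unit
open import Relation.Nullary using (¬_)
open import Relation.Binary.PropositionalEquality using (_≡_; _≢_)
open import Function.Definitions using (Injective)

Compl : {V : Set} → (V → V → Set) → V → V → Set
Compl E u v = (u ≢ v) × ¬ E u v

CycAdj : (k : ℕ) → Fin (suc k) → Fin (suc k) → Set
CycAdj k i j = (suc (toℕ i) % suc k ≡ toℕ j) ⊎ (suc (toℕ j) % suc k ≡ toℕ i)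

InducedCycle : {V : Set} → (V → V → Set) → ℕ → Set
InducedCycle {V} E m =
  Σ (Fin (5 + m) → V) λ f →
    Injective _≡_ _≡_ f ×
    (∀ i j → (E (f i) (f j) → CycAdj (4 + m) i j) × (CycAdj (4 + m) i j → E (f i) (f j)))

WeaklyChordal : {V : Set} → (V → V → Set) → Set
WeaklyChordal E = (∀ m → ¬ InducedCycle E m) × (∀ m → ¬ InducedCycle (Compl E) m)

-- A literal: (i , true) is x_i, (i , false) is its negation.
Lit : ℕ → Set
Lit p = Fin p × Bool

Clause : ℕ → Set
Clause p = Lit p × Lit p × Lit p

Distinct3 : {p : ℕ} → Clause p → Set
Distinct3 (l₁ , l₂ , l₃) = (l₁ ≢ l₂) × (l₁ ≢ l₃) × (l₂ ≢ l₃)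

Occurs : {p : ℕ} → Lit p → Clause p → Set
Occurs l (l₁ , l₂ , l₃) = (l ≡ l₁) ⊎ (l ≡ l₂) ⊎ (l ≡ l₃)

data Vtx (p q : ℕ) : Set where
  lit : Lit p → Vtx p q
  cl  : Fin q → Vtx p q
  a₁ a₂ u₁ u₂ b y z : Vtx p q

-- Each edge listed once (in one orientation).
module _ {p q : ℕ} (cls : Fin q → Clause p) where

  BaseEdge : Vtx p q → Vtx p q → Set
  BaseEdge (lit (i , _)) (lit (j , _)) = i ≢ j
  BaseEdge (lit l) (cl c) = ¬ Occurs l (cls c)
  BaseEdge a₁ a₂ = Data.Unit.⊤
  BaseEdge u₁ u₂ = Data.Unit.⊤
  BaseEdge y z = Data.Unit.⊤
  BaseEdge b (lit _) = Data.Unit.⊤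
  BaseEdge z (lit _) = Data.Unit.⊤
  BaseEdge a₂ (lit _) = Data.Unit.⊤
  BaseEdge a₂ (cl _) = Data.Unit.⊤
  BaseEdge u₁ (lit _) = Data.Unit.⊤
  BaseEdge u₁ (cl _) = Data.Unit.⊤
  BaseEdge u₂ (lit _) = Data.Unit.⊤
  BaseEdge u₂ (cl _) = Data.Unit.⊤
  BaseEdge y (lit _) = Data.Unit.⊤
  BaseEdge y (cl _) = Data.Unit.⊤
  BaseEdge _ _ = ⊥

  G : Vtx p q → Vtx p q → Set
  G u v = BaseEdge u v ⊎ BaseEdge v u

-- An induced cycle on 5 + m vertices is first turned into an abstract `Hole`:
-- a vertex set in which every edge extends to an induced path on three
-- vertices and no two distinct vertices have two common neighbours
-- (`holeOfCycle`, by arithmetic on positions modulo 5 + m).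
-- In both graphs the vertex classes are excluded one at a time: first a₁,
-- then clause and literal vertices, using that complementary literals are
-- the only non-adjacent pairs of literals.  What remains are the six special
-- vertices a₂, u₁, u₂, b, y, z, on which G induces only the edges u₁u₂ and
-- yz; this leaves no room for a hole in G nor in Ḡ.

module Submission where

open import Data.Nat using (ℕ; _+_; _%_; _<_; NonZero; z<s; s<s)
open import Data.Nat.Properties
  using ( _<?_; ≮⇒≥; m<n+m; m≤m+n; <-≤-trans; <-trans; +-comm; +-assoc
        ; +-cancelˡ-<; +-monoˡ-<; <⇒≢; >⇒≢; m≤n⇒∃[o]m+o≡n )
open import Data.Nat.DivMod using (m%n<n; m<n⇒m%n≡m; [m+n]%n≡m%n; %-distribˡ-+; m%n%n≡m%n)
open import Data.Fin using (Fin; toℕ; fromℕ<; _≟_)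
open import Data.Fin.Properties using (toℕ-injective; toℕ-fromℕ<; toℕ<n)
open import Data.Bool using (true; false; not)
open import Data.Bool.Properties using (¬-not)
open import Data.Product using (Σ; _×_; _,_; proj₁; proj₂)
open import Data.Sum using (_⊎_; inj₁; inj₂; swap)
open import Data.Empty using (⊥; ⊥-elim)
open import Relation.Nullary using (¬_; yes; no)
open import Relation.Binary.PropositionalEquality
open import Defs

shiftMoves : ∀ n k x .{{_ : NonZero n}} → 0 < k → k < n → x < n → (k + x) % n ≢ x
shiftMoves n k x 0<k k<n x<n eq with k + x <? n
... | yes k+x<n = >⇒≢ (m<n+m x 0<k) (trans (sym (m<n⇒m%n≡m k+x<n)) eq)
... | no k+x≮n with m≤n⇒∃[o]m+o≡n (≮⇒≥ k+x≮n)
...   | o , n+o≡k+x = <⇒≢ o<x (trans (sym wrapped) eq)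
  where
  o<x : o < x
  o<x = +-cancelˡ-< n o x (subst (_< n + x) (sym n+o≡k+x) (+-monoˡ-< x k<n))
  wrapped : (k + x) % n ≡ o
  wrapped = begin
    (k + x) % n ≡⟨ cong (_% n) (trans (sym n+o≡k+x) (+-comm n o)) ⟩
    (o + n) % n ≡⟨ [m+n]%n≡m%n o n ⟩
    o % n       ≡⟨ m<n⇒m%n≡m (<-trans o<x x<n) ⟩
    o           ∎
    where open ≡-Reasoning

module CyclePositions (m : ℕ) where

  n : ℕ
  n = 5 + m

  shift : ℕ → Fin n → Fin n
  shift k i = fromℕ< (m%n<n (k + toℕ i) n)

  toℕ-shift : ∀ k i → toℕ (shift k i) ≡ (k + toℕ i) % n
  toℕ-shift k i = toℕ-fromℕ< (m%n<n (k + toℕ i) n)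

  shift-shift : ∀ k l i → shift k (shift l i) ≡ shift (k + l) i
  shift-shift k l i = toℕ-injective (begin
    toℕ (shift k (shift l i))     ≡⟨ toℕ-shift k (shift l i) ⟩
    (k + toℕ (shift l i)) % n     ≡⟨ cong (λ r → (k + r) % n) (toℕ-shift l i) ⟩
    (k + (l + toℕ i) % n) % n     ≡⟨ %-distribˡ-+ k ((l + toℕ i) % n) n ⟩
    (k % n + (l + toℕ i) % n % n) % n ≡⟨ cong (λ r → (k % n + r) % n) (m%n%n≡m%n (l + toℕ i) n) ⟩
    (k % n + (l + toℕ i) % n) % n ≡⟨ sym (%-distribˡ-+ k (l + toℕ i) n) ⟩
    (k + (l + toℕ i)) % n         ≡⟨ cong (_% n) (sym (+-assoc k l (toℕ i))) ⟩
    (k + l + toℕ i) % n           ≡⟨ sym (toℕ-shift (k + l) i) ⟩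
    toℕ (shift (k + l) i)         ∎)
    where open ≡-Reasoning

  shift-full : ∀ i → shift n i ≡ i
  shift-full i = toℕ-injective (begin
    toℕ (shift n i)   ≡⟨ toℕ-shift n i ⟩
    (n + toℕ i) % n   ≡⟨ cong (_% n) (+-comm n (toℕ i)) ⟩
    (toℕ i + n) % n   ≡⟨ [m+n]%n≡m%n (toℕ i) n ⟩
    toℕ i % n         ≡⟨ m<n⇒m%n≡m (toℕ<n i) ⟩
    toℕ i             ∎)
    where open ≡-Reasoning

  -- A rotation by 1, 2, 3 or 4 steps fixes no position, since n ≥ 5.
  shift-moves : ∀ k → 0 < k → k < 5 → ∀ i → shift k i ≢ i
  shift-moves k 0<k k<5 i eq =
    shiftMoves n k (toℕ i) 0<k (<-≤-trans k<5 (m≤m+n 5 m)) (toℕ<n i)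
      (trans (sym (toℕ-shift k i)) (cong toℕ eq))

  next previous : Fin n → Fin n
  next = shift 1
  previous = shift (4 + m)

  next-previous : ∀ i → next (previous i) ≡ i
  next-previous i = trans (shift-shift 1 (4 + m) i) (shift-full i)

  previous-next : ∀ i → previous (next i) ≡ i
  previous-next i =
    trans (shift-shift (4 + m) 1 i) (trans (cong (λ k → shift k i) (+-comm (4 + m) 1)) (shift-full i))

  Adj : Fin n → Fin n → Set
  Adj i j = j ≡ next i ⊎ i ≡ next j

  adjSym : ∀ {i j} → Adj i j → Adj j i
  adjSym = swap

  adjPrevious : ∀ i → Adj i (previous i)
  adjPrevious i = inj₂ (sym (next-previous i))

  neighbours : ∀ {i j} → Adj i j → j ≡ next i ⊎ j ≡ previous i
  neighbours (inj₁ j≡next) = inj₁ j≡next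
  neighbours {i} {j} (inj₂ i≡next) = inj₂ (trans (sym (previous-next j)) (cong previous (sym i≡next)))

  next≢previous : ∀ i → next i ≢ previous i
  next≢previous i eq = shift-moves 2 z<s (s<s (s<s z<s)) i (begin
    shift 2 i            ≡⟨ sym (shift-shift 1 1 i) ⟩
    next (next i)        ≡⟨ cong next eq ⟩
    next (previous i)    ≡⟨ next-previous i ⟩
    i                    ∎)
    where open ≡-Reasoning

  -- The two neighbours of a position are not adjacent, since n ≠ 3.
  neighboursNotAdj : ∀ i → ¬ Adj (next i) (previous i)
  neighboursNotAdj i (inj₁ prev≡next²) = shift-moves 3 z<s (s<s (s<s (s<s z<s))) i (begin
    shift 3 i               ≡⟨ sym (shift-shift 1 2 i) ⟩
    next (shift 2 i)        ≡⟨ cong next (sym (shift-shift 1 1 i)) ⟩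
    next (next (next i))    ≡⟨ cong next (sym prev≡next²) ⟩
    next (previous i)       ≡⟨ next-previous i ⟩
    i                       ∎)
    where open ≡-Reasoning
  neighboursNotAdj i (inj₂ next≡next-prev) =
    shift-moves 1 z<s (s<s z<s) i (trans next≡next-prev (next-previous i))

  -- The two neighbours of i have no common neighbour besides i, since n ≠ 4.
  commonNeighbour : ∀ {i j} → Adj (next i) j → Adj (previous i) j → j ≡ i
  commonNeighbour {i} {j} a₊ a₋ with neighbours a₊ | neighbours a₋
  ... | inj₂ j≡prev-next | _ = trans j≡prev-next (previous-next i)
  ... | inj₁ _ | inj₁ j≡next-prev = trans j≡next-prev (next-previous i)
  ... | inj₁ j≡next² | inj₂ j≡prev² = ⊥-elim (shift-moves 4 z<s (s<s (s<s (s<s (s<s z<s)))) i (begin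
    shift 4 i                            ≡⟨ sym (shift-shift 2 2 i) ⟩
    shift 2 (shift 2 i)                  ≡⟨ cong (shift 2) (shift-shift 1 1 i) ⟨
    shift 2 (next (next i))              ≡⟨ cong (shift 2) (trans (sym j≡next²) j≡prev²) ⟩
    shift 2 (previous (previous i))      ≡⟨ shift-shift 1 1 (previous (previous i)) ⟨
    next (next (previous (previous i)))  ≡⟨ cong next (next-previous (previous i)) ⟩
    next (previous i)                    ≡⟨ next-previous i ⟩
    i                                    ∎))
    where open ≡-Reasoning

  noSquare : ∀ {x₁ x₂ y₁ y₂} → x₁ ≢ x₂ → y₁ ≢ y₂ →
             Adj x₁ y₁ → Adj x₁ y₂ → Adj x₂ y₁ → Adj x₂ y₂ → ⊥
  noSquare x₁≢x₂ y₁≢y₂ a₁₁ a₁₂ a₂₁ a₂₂ with neighbours (adjSym a₁₁) | neighbours (adjSym a₂₁)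
  ... | inj₁ refl | inj₁ refl = x₁≢x₂ refl
  ... | inj₂ refl | inj₂ refl = x₁≢x₂ refl
  ... | inj₁ refl | inj₂ refl = y₁≢y₂ (sym (commonNeighbour a₁₂ a₂₂))
  ... | inj₂ refl | inj₁ refl = y₁≢y₂ (sym (commonNeighbour a₂₂ a₁₂))

  fromCycAdj : ∀ {i j} → CycAdj (4 + m) i j → Adj i j
  fromCycAdj {i} {j} (inj₁ e) = inj₁ (toℕ-injective (trans (sym e) (sym (toℕ-shift 1 i))))
  fromCycAdj {i} {j} (inj₂ e) = inj₂ (toℕ-injective (trans (sym e) (sym (toℕ-shift 1 j))))

  toCycAdj : ∀ {i j} → Adj i j → CycAdj (4 + m) i j
  toCycAdj {i} (inj₁ refl) = inj₁ (sym (toℕ-shift 1 i))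
  toCycAdj {j = j} (inj₂ refl) = inj₂ (sym (toℕ-shift 1 j))

-- The properties of a hole (an induced cycle on at least five vertices)
-- used below; `In` is its vertex set.
record Hole {V : Set} (E : V → V → Set) : Set₁ where
  field
    In             : V → Set
    vertex         : Σ V In
    symmetric      : ∀ {v w} → In v → In w → E v w → E w v
    neighbour      : ∀ {v} → In v → Σ V λ w → In w × E v w
    otherNeighbour : ∀ {v w} → In v → In w → E v w →
                     Σ V λ t → In t × E v t × t ≢ w × ¬ E w t
    noSquare       : ∀ {x₁ x₂ y₁ y₂} → In x₁ → In x₂ → In y₁ → In y₂ →
                     x₁ ≢ x₂ → y₁ ≢ y₂ → E x₁ y₁ → E x₁ y₂ → E x₂ y₁ → E x₂ y₂ → ⊥

holeOfCycle : ∀ {V : Set} {E : V → V → Set} m → InducedCycle E m → Hole E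
holeOfCycle {V} {E} m (f , f-injective , f-induced) = record
  { In             = OnCycle
  ; vertex         = f Data.Fin.zero , Data.Fin.zero , refl
  ; symmetric      = λ { (i , refl) (j , refl) e → edge (adjSym (adj e)) }
  ; neighbour      = λ { (i , refl) → f (next i) , (next i , refl) , edge (inj₁ refl) }
  ; otherNeighbour = other
  ; noSquare       = λ { (i₁ , refl) (i₂ , refl) (j₁ , refl) (j₂ , refl) x₁≢x₂ y₁≢y₂ e₁₁ e₁₂ e₂₁ e₂₂ →
      noSquare (λ eq → x₁≢x₂ (cong f eq)) (λ eq → y₁≢y₂ (cong f eq))
               (adj e₁₁) (adj e₁₂) (adj e₂₁) (adj e₂₂) }
  }
  where
  open CyclePositions m

  OnCycle : V → Set
  OnCycle v = Σ (Fin n) λ i → f i ≡ v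

  adj : ∀ {i j} → E (f i) (f j) → Adj i j
  adj {i} {j} e = fromCycAdj (proj₁ (f-induced i j) e)

  edge : ∀ {i j} → Adj i j → E (f i) (f j)
  edge {i} {j} a = proj₂ (f-induced i j) (toCycAdj a)

  other : ∀ {v w} → OnCycle v → OnCycle w → E v w →
          Σ V λ t → OnCycle t × E v t × t ≢ w × ¬ E w t
  other (i , refl) (j , refl) e with neighbours (adj e)
  ... | inj₁ refl = f (previous i) , (previous i , refl) , edge (adjPrevious i) ,
                    (λ eq → next≢previous i (f-injective (sym eq))) ,
                    (λ e′ → neighboursNotAdj i (adj e′))
  ... | inj₂ refl = f (next i) , (next i , refl) , edge (inj₁ refl) ,
                    (λ eq → next≢previous i (f-injective eq)) ,
                    (λ e′ → neighboursNotAdj i (adjSym (adj e′)))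

module HoleFacts {V : Set} {E : V → V → Set} (H : Hole E) where
  open Hole H public

  record Wedge (v : V) : Set where
    constructor wedge
    field
      w₁ w₂    : V
      in₁      : In w₁
      in₂      : In w₂
      edge₁    : E v w₁
      edge₂    : E v w₂
      distinct : w₁ ≢ w₂
      nonEdge  : ¬ E w₁ w₂

  wedgeAt : ∀ {v} → In v → Wedge v
  wedgeAt iv with neighbour iv
  ... | w₁ , i₁ , e₁ with otherNeighbour iv i₁ e₁
  ...   | w₂ , i₂ , e₂ , w₂≢w₁ , ¬w₁w₂ = wedge w₁ w₂ i₁ i₂ e₁ e₂ (λ eq → w₂≢w₁ (sym eq)) ¬w₁w₂

  flipWedge : ∀ {v} → Wedge v → Wedge v
  flipWedge (wedge w₁ w₂ i₁ i₂ e₁ e₂ w₁≢w₂ ¬w₁w₂) =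
    wedge w₂ w₁ i₂ i₁ e₂ e₁ (λ eq → w₁≢w₂ (sym eq)) (λ e → ¬w₁w₂ (symmetric i₂ i₁ e))

  -- Beyond w₁ the hole continues to a vertex t adjacent to neither v nor w₂
  -- (adjacency to w₂ would make v and t two vertices with common neighbours w₁, w₂).
  farNeighbour : ∀ {v} → In v → (W : Wedge v) → let open Wedge W in
                 Σ V λ t → In t × E w₁ t × t ≢ v × ¬ E v t × ¬ E w₂ t
  farNeighbour iv (wedge w₁ w₂ i₁ i₂ e₁ e₂ w₁≢w₂ _) with otherNeighbour i₁ iv (symmetric iv i₁ e₁)
  ... | t , iₜ , w₁t , t≢v , ¬vt = t , iₜ , w₁t , t≢v , ¬vt , λ w₂t →
    noSquare iv iₜ i₁ i₂ (λ eq → t≢v (sym eq)) w₁≢w₂ e₁ e₂ (symmetric i₁ iₜ w₁t) (symmetric i₂ iₜ w₂t)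

  noPendant : ∀ {v x} → In v → (∀ {w} → In w → E v w → w ≡ x) → ⊥
  noPendant iv only-x with wedgeAt iv
  ... | wedge w₁ w₂ i₁ i₂ e₁ e₂ w₁≢w₂ _ = w₁≢w₂ (trans (only-x i₁ e₁) (sym (only-x i₂ e₂)))

  -- Dually, a vertex adjacent to all other hole vertices except possibly x is
  -- not on the hole: the far neighbours beyond its two hole neighbours w₁, w₂ are
  -- non-neighbours of it, and they differ since only the second one sees w₂.
  noNearlyUniversal : ∀ {v x} → In v → (∀ {t} → In t → t ≢ v → ¬ E v t → t ≡ x) → ⊥
  noNearlyUniversal iv only-x with wedgeAt iv
  ... | W with farNeighbour iv W | farNeighbour iv (flipWedge W)
  ...   | t , iₜ , _ , t≢v , ¬vt , ¬w₂t | t′ , iₜ′ , w₂t′ , t′≢v , ¬vt′ , _ =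
    ¬w₂t (subst (E (Wedge.w₂ W)) (trans (only-x iₜ′ t′≢v ¬vt′) (sym (only-x iₜ t≢v ¬vt))) w₂t′)

module Construction {p q : ℕ} (cls : Fin q → Clause p) where

  E : Vtx p q → Vtx p q → Set
  E = G cls

  Ē : Vtx p q → Vtx p q → Set
  Ē = Compl E

  E-sym : ∀ {u v} → E u v → E v u
  E-sym = swap

  Ē-sym : ∀ {u v} → Ē u v → Ē v u
  Ē-sym (u≢v , ¬uv) = (λ eq → u≢v (sym eq)) , (λ vu → ¬uv (E-sym vu))

  noEdge : ∀ {A : Set} → ⊥ ⊎ ⊥ → A
  noEdge (inj₁ ())
  noEdge (inj₂ ())

  neg : Lit p → Lit p
  neg ℓ = proj₁ ℓ , not (proj₂ ℓ)

  litNeg≢ : ∀ {ℓ} → lit {q = q} ℓ ≢ lit (neg ℓ)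
  litNeg≢ {_ , true}  ()
  litNeg≢ {_ , false} ()

  complementNotAdjacent : ∀ ℓ → ¬ E (lit ℓ) (lit (neg ℓ))
  complementNotAdjacent ℓ (inj₁ i≢i) = i≢i refl
  complementNotAdjacent ℓ (inj₂ i≢i) = i≢i refl

  nonAdjacentLiterals : ∀ {ℓ ℓ′} → ℓ′ ≢ ℓ → ¬ E (lit ℓ) (lit ℓ′) → ℓ′ ≡ neg ℓ
  nonAdjacentLiterals {i , s} {j , t} ℓ′≢ℓ ¬ℓℓ′ with i ≟ j
  ... | yes refl = cong (i ,_) (¬-not (λ t≡s → ℓ′≢ℓ (cong (i ,_) t≡s)))
  ... | no i≢j   = ⊥-elim (¬ℓℓ′ (inj₁ i≢j))

  data Special : Vtx p q → Set where
    sa₂ : Special a₂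
    su₁ : Special u₁
    su₂ : Special u₂
    sb  : Special b
    sy  : Special y
    sz  : Special z

  data View : Vtx p q → Set where
    literal : ∀ ℓ → View (lit ℓ)
    clause  : ∀ c → View (cl c)
    pendant : View a₁
    special : ∀ {v} → Special v → View v

  view : ∀ v → View v
  view (lit ℓ) = literal ℓ
  view (cl c)  = clause c
  view a₁      = pendant
  view a₂      = special sa₂
  view u₁      = special su₁
  view u₂      = special su₂
  view b       = special sb
  view y       = special sy
  view z       = special sz

  specialSeesLiterals : ∀ {v} → Special v → ∀ ℓ → E v (lit ℓ)
  specialSeesLiterals sa₂ ℓ = inj₁ _
  specialSeesLiterals su₁ ℓ = inj₁ _
  specialSeesLiterals su₂ ℓ = inj₁ _
  specialSeesLiterals sb  ℓ = inj₁ _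
  specialSeesLiterals sy  ℓ = inj₁ _
  specialSeesLiterals sz  ℓ = inj₁ _

  specialSeesClauses : ∀ {v c} → Special v → E (cl c) v → ∀ d → E v (cl d)
  specialSeesClauses sa₂ _ d = inj₁ _
  specialSeesClauses su₁ _ d = inj₁ _
  specialSeesClauses su₂ _ d = inj₁ _
  specialSeesClauses sb  e d = noEdge e
  specialSeesClauses sy  _ d = inj₁ _
  specialSeesClauses sz  e d = noEdge e

  data Partners : Vtx p q → Vtx p q → Set where
    u₁u₂ : Partners u₁ u₂
    u₂u₁ : Partners u₂ u₁
    yz   : Partners y z
    zy   : Partners z y

  partnersEdge : ∀ {v w} → Partners v w → E v w
  partnersEdge u₁u₂ = inj₁ _
  partnersEdge u₂u₁ = inj₂ _
  partnersEdge yz   = inj₁ _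
  partnersEdge zy   = inj₂ _

  partnersSym : ∀ {v w} → Partners v w → Partners w v
  partnersSym u₁u₂ = u₂u₁
  partnersSym u₂u₁ = u₁u₂
  partnersSym yz   = zy
  partnersSym zy   = yz

  partnerUnique : ∀ {v w w′} → Partners v w → Partners v w′ → w ≡ w′
  partnerUnique u₁u₂ u₁u₂ = refl
  partnerUnique u₂u₁ u₂u₁ = refl
  partnerUnique yz   yz   = refl
  partnerUnique zy   zy   = refl

  specialEdge : ∀ {v w} → Special v → Special w → E v w → Partners v w
  specialEdge sa₂ sa₂ e = noEdge e
  specialEdge sa₂ su₁ e = noEdge e
  specialEdge sa₂ su₂ e = noEdge e
  specialEdge sa₂ sb  e = noEdge e
  specialEdge sa₂ sy  e = noEdge e
  specialEdge sa₂ sz  e = noEdge e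
  specialEdge su₁ sa₂ e = noEdge e
  specialEdge su₁ su₁ e = noEdge e
  specialEdge su₁ su₂ e = u₁u₂
  specialEdge su₁ sb  e = noEdge e
  specialEdge su₁ sy  e = noEdge e
  specialEdge su₁ sz  e = noEdge e
  specialEdge su₂ sa₂ e = noEdge e
  specialEdge su₂ su₁ e = u₂u₁
  specialEdge su₂ su₂ e = noEdge e
  specialEdge su₂ sb  e = noEdge e
  specialEdge su₂ sy  e = noEdge e
  specialEdge su₂ sz  e = noEdge e
  specialEdge sb  sa₂ e = noEdge e
  specialEdge sb  su₁ e = noEdge e
  specialEdge sb  su₂ e = noEdge e
  specialEdge sb  sb  e = noEdge e
  specialEdge sb  sy  e = noEdge e
  specialEdge sb  sz  e = noEdge e
  specialEdge sy  sa₂ e = noEdge e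
  specialEdge sy  su₁ e = noEdge e
  specialEdge sy  su₂ e = noEdge e
  specialEdge sy  sb  e = noEdge e
  specialEdge sy  sy  e = noEdge e
  specialEdge sy  sz  e = yz
  specialEdge sz  sa₂ e = noEdge e
  specialEdge sz  su₁ e = noEdge e
  specialEdge sz  su₂ e = noEdge e
  specialEdge sz  sb  e = noEdge e
  specialEdge sz  sy  e = zy
  specialEdge sz  sz  e = noEdge e

  module NoHole (H : Hole E) where
    open HoleFacts H

    -- a₁ has the single neighbour a₂.
    noA₁ : ¬ In a₁
    noA₁ ia₁ = noPendant ia₁ (λ {w} _ e → onlyA₂ w e)
      where
      onlyA₂ : ∀ w → E a₁ w → w ≡ a₂
      onlyA₂ (lit _) e = noEdge e
      onlyA₂ (cl _)  e = noEdge e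
      onlyA₂ a₁      e = noEdge e
      onlyA₂ a₂      _ = refl
      onlyA₂ u₁      e = noEdge e
      onlyA₂ u₂      e = noEdge e
      onlyA₂ b       e = noEdge e
      onlyA₂ y       e = noEdge e
      onlyA₂ z       e = noEdge e

    -- Complementary literals ℓ, ℓ̄ cannot both lie on the hole with a common
    -- neighbour v: the far neighbour of ℓ would be a clause vertex d containing ℓ̄
    -- (literal and special vertices see ℓ and ℓ̄ alike), and the neighbour of d
    -- beyond ℓ would have to be ℓ̄ itself, which is not adjacent to d.
    complementaryPair : ∀ {v ℓ} → In v → In (lit ℓ) → In (lit (neg ℓ)) →
                        E v (lit ℓ) → E v (lit (neg ℓ)) → ⊥
    complementaryPair {v} {ℓ} iv iℓ iℓ̄ vℓ vℓ̄
      with farNeighbour iv (wedge _ _ iℓ iℓ̄ vℓ vℓ̄ litNeg≢ (complementNotAdjacent ℓ))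
    ... | t , iₜ , ℓt , _ , _ , ¬ℓ̄t = beyond (view t) iₜ ℓt ¬ℓ̄t
      where
      beyondClause : ∀ {d} → In (cl d) → E (lit ℓ) (cl d) → ¬ E (lit (neg ℓ)) (cl d) → ⊥
      beyondClause {d} id ℓd ¬ℓ̄d with otherNeighbour id iℓ (E-sym {lit ℓ} {cl d} ℓd)
      ... | r , _ , dr , r≢ℓ , ¬ℓr = past (view r) dr r≢ℓ ¬ℓr
        where
        past : ∀ {r} → View r → E (cl d) r → r ≢ lit ℓ → ¬ E (lit ℓ) r → ⊥
        past (literal _) dr r≢ℓ ¬ℓr with nonAdjacentLiterals (λ eq → r≢ℓ (cong lit eq)) ¬ℓr
        ... | refl = ¬ℓ̄d (E-sym {cl d} {lit (neg ℓ)} dr)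
        past (clause _)  dr _ _   = noEdge dr
        past pendant     dr _ _   = noEdge dr
        past (special s) _  _ ¬ℓs = ¬ℓs (E-sym (specialSeesLiterals s ℓ))

      beyond : ∀ {t} → View t → In t → E (lit ℓ) t → ¬ E (lit (neg ℓ)) t → ⊥
      beyond (literal _) _  ℓt ¬ℓ̄t = ¬ℓ̄t ℓt
      beyond (clause _)  id ℓd ¬ℓ̄d = beyondClause id ℓd ¬ℓ̄d
      beyond pendant     _  ℓa₁ _  = noEdge ℓa₁
      beyond (special s) _  _  ¬ℓ̄s = ¬ℓ̄s (E-sym (specialSeesLiterals s (neg ℓ)))

    -- If the two hole neighbours of a clause vertex c are special, the first is y:
    -- the far neighbour of w₁ sees neither c nor w₂, so it is the partner of w₁,
    -- and of the partners of the special neighbours of c only z misses c.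
    specialWedgeAtClause : ∀ {c} → In (cl c) → (W : Wedge (cl c)) →
                           Special (Wedge.w₁ W) → Special (Wedge.w₂ W) → Wedge.w₁ W ≡ y
    specialWedgeAtClause {c} ic W s₁ s₂ with farNeighbour ic W
    ... | t , iₜ , w₁t , _ , ¬ct , ¬w₂t = go (view t) iₜ w₁t ¬ct ¬w₂t
      where
      open Wedge W

      viaPartner : ∀ {t} → Partners w₁ t → ¬ E (cl c) t → w₁ ≡ y
      viaPartner u₁u₂ ¬cu₂ = ⊥-elim (¬cu₂ (inj₂ _))
      viaPartner u₂u₁ ¬cu₁ = ⊥-elim (¬cu₁ (inj₂ _))
      viaPartner yz   _    = refl
      viaPartner zy   _    = noEdge edge₁

      go : ∀ {t} → View t → In t → E w₁ t → ¬ E (cl c) t → ¬ E w₂ t → w₁ ≡ y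
      go (literal ℓ)  _  _   _   ¬w₂t = ⊥-elim (¬w₂t (specialSeesLiterals s₂ ℓ))
      go (clause d)   _  _   _   ¬w₂t = ⊥-elim (¬w₂t (specialSeesClauses s₂ edge₂ d))
      go pendant      iₜ _   _   _    = ⊥-elim (noA₁ iₜ)
      go (special sₜ) _  w₁t ¬ct _    = viaPartner (specialEdge s₁ sₜ w₁t) ¬ct

    noClause : ∀ {c} → ¬ In (cl c)
    noClause ic with wedgeAt ic
    ... | W@(wedge w₁ w₂ i₁ i₂ e₁ e₂ w₁≢w₂ ¬w₁w₂) with view w₁ | view w₂
    ...   | literal ℓ | literal ℓ′ with nonAdjacentLiterals (λ eq → w₁≢w₂ (cong lit (sym eq))) ¬w₁w₂
    ...     | refl = complementaryPair ic i₁ i₂ e₁ e₂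
    noClause ic | W | literal ℓ  | special s  = Wedge.nonEdge W (E-sym (specialSeesLiterals s ℓ))
    noClause ic | W | special s  | literal ℓ  = Wedge.nonEdge W (specialSeesLiterals s ℓ)
    noClause ic | W | special s₁ | special s₂ = Wedge.distinct W
      (trans (specialWedgeAtClause ic W s₁ s₂) (sym (specialWedgeAtClause ic (flipWedge W) s₂ s₁)))
    noClause ic | W | clause _   | _          = noEdge (Wedge.edge₁ W)
    noClause ic | W | pendant    | _          = noEdge (Wedge.edge₁ W)
    noClause ic | W | _          | clause _   = noEdge (Wedge.edge₂ W)
    noClause ic | W | _          | pendant    = noEdge (Wedge.edge₂ W)

    -- No literal vertex lies on the hole: its two hole neighbours would be
    -- complementary literals, or two special vertices, whose far neighbours are
    -- literal or special and hence adjacent to the special vertex or literal.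
    noLiteral : ∀ {ℓ} → ¬ In (lit ℓ)
    noLiteral {ℓ} iℓ with wedgeAt iℓ
    ... | W@(wedge w₁ w₂ i₁ i₂ e₁ e₂ w₁≢w₂ ¬w₁w₂) with view w₁ | view w₂
    ...   | literal ℓ₁ | literal ℓ₂ with nonAdjacentLiterals (λ eq → w₁≢w₂ (cong lit (sym eq))) ¬w₁w₂
    ...     | refl = complementaryPair iℓ i₁ i₂ e₁ e₂
    noLiteral iℓ | W | literal ℓ₁ | special s  = Wedge.nonEdge W (E-sym (specialSeesLiterals s ℓ₁))
    noLiteral iℓ | W | special s  | literal ℓ₂ = Wedge.nonEdge W (specialSeesLiterals s ℓ₂)
    noLiteral iℓ | W | clause _   | _          = noClause (Wedge.in₁ W)
    noLiteral iℓ | W | pendant    | _          = noA₁ (Wedge.in₁ W)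
    noLiteral iℓ | W | _          | clause _   = noClause (Wedge.in₂ W)
    noLiteral iℓ | W | _          | pendant    = noA₁ (Wedge.in₂ W)
    noLiteral {ℓ} iℓ | W | special s₁ | special s₂ with farNeighbour iℓ W
    ... | t , iₜ , _ , _ , ¬ℓt , ¬w₂t with view t
    ...   | literal ℓ′ = ¬w₂t (specialSeesLiterals s₂ ℓ′)
    ...   | clause _   = noClause iₜ
    ...   | pendant    = noA₁ iₜ
    ...   | special sₜ = ¬ℓt (E-sym (specialSeesLiterals sₜ ℓ))

    specialOnly : ∀ {v} → In v → Special v
    specialOnly {v} iv with view v
    ... | literal _ = ⊥-elim (noLiteral iv)
    ... | clause _  = ⊥-elim (noClause iv)
    ... | pendant   = ⊥-elim (noA₁ iv)
    ... | special s = s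

    -- But every special vertex has at most one special neighbour.
    impossible : ⊥
    impossible with vertex
    ... | v , iv with wedgeAt iv
    ...   | wedge w₁ w₂ i₁ i₂ e₁ e₂ w₁≢w₂ _ =
      w₁≢w₂ (partnerUnique (specialEdge (specialOnly iv) (specialOnly i₁) e₁)
                           (specialEdge (specialOnly iv) (specialOnly i₂) e₂))

  module NoAntihole (H : Hole Ē) where
    open HoleFacts H

    -- In Ḡ, a₁ is adjacent to every vertex except a₂.
    noA₁ : ¬ In a₁
    noA₁ ia₁ = noNearlyUniversal ia₁ (λ {t} _ t≢a₁ ¬a₁t → onlyA₂ t t≢a₁ ¬a₁t)
      where
      onlyA₂ : ∀ t → t ≢ a₁ → ¬ Ē a₁ t → t ≡ a₂
      onlyA₂ (lit _) _    ¬a₁t = ⊥-elim (¬a₁t ((λ ()) , noEdge))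
      onlyA₂ (cl _)  _    ¬a₁t = ⊥-elim (¬a₁t ((λ ()) , noEdge))
      onlyA₂ a₁      t≢a₁ _    = ⊥-elim (t≢a₁ refl)
      onlyA₂ a₂      _    _    = refl
      onlyA₂ u₁      _    ¬a₁t = ⊥-elim (¬a₁t ((λ ()) , noEdge))
      onlyA₂ u₂      _    ¬a₁t = ⊥-elim (¬a₁t ((λ ()) , noEdge))
      onlyA₂ b       _    ¬a₁t = ⊥-elim (¬a₁t ((λ ()) , noEdge))
      onlyA₂ y       _    ¬a₁t = ⊥-elim (¬a₁t ((λ ()) , noEdge))
      onlyA₂ z       _    ¬a₁t = ⊥-elim (¬a₁t ((λ ()) , noEdge))

    data LiteralCoNeighbour (ℓ : Lit p) : Vtx p q → Set where
      complement : LiteralCoNeighbour ℓ (lit (neg ℓ))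
      clause     : ∀ d → LiteralCoNeighbour ℓ (cl d)

    literalCoNeighbour : ∀ {ℓ w} → In w → Ē (lit ℓ) w → LiteralCoNeighbour ℓ w
    literalCoNeighbour {ℓ} {w} iw (ℓ≢w , ¬ℓw) with view w
    ... | literal ℓ′ with nonAdjacentLiterals (λ eq → ℓ≢w (cong lit (sym eq))) ¬ℓw
    ...   | refl = complement
    literalCoNeighbour iw _ | clause d = clause d
    literalCoNeighbour iw _ | pendant  = ⊥-elim (noA₁ iw)
    literalCoNeighbour {ℓ} iw (_ , ¬ℓs) | special s = ⊥-elim (¬ℓs (E-sym (specialSeesLiterals s ℓ)))

    -- A literal ℓ on the hole has hole neighbours ℓ̄ and a clause d with d ≁ ℓ̄ in Ḡ
    -- (two clause vertices are adjacent in Ḡ, and ℓ̄ is the only literal one).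
    record LiteralWedge (ℓ : Lit p) : Set where
      field
        d               : Fin q
        complementOnHole : In (lit (neg ℓ))
        clauseOnHole    : In (cl d)
        toClause        : Ē (lit ℓ) (cl d)
        complementMisses : ¬ Ē (lit (neg ℓ)) (cl d)

    literalWedge : ∀ {ℓ} → In (lit ℓ) → LiteralWedge ℓ
    literalWedge iℓ with wedgeAt iℓ
    ... | wedge w₁ w₂ i₁ i₂ e₁ e₂ w₁≢w₂ ¬w₁w₂ with literalCoNeighbour i₁ e₁ | literalCoNeighbour i₂ e₂
    ...   | complement | complement = ⊥-elim (w₁≢w₂ refl)
    ...   | complement | clause d   = record { d = d ; complementOnHole = i₁ ; clauseOnHole = i₂
                                             ; toClause = e₂ ; complementMisses = ¬w₁w₂ }
    ...   | clause d   | complement = record { d = d ; complementOnHole = i₂ ; clauseOnHole = i₁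
                                             ; toClause = e₁ ; complementMisses = λ e → ¬w₁w₂ (Ē-sym e) }
    ...   | clause _   | clause _   = ⊥-elim (¬w₁w₂ (w₁≢w₂ , noEdge))

    -- No literal lies on the hole: with d from ℓ and d′ from ℓ̄, the vertices
    -- ℓ and d′ would have the two common neighbours d and ℓ̄.
    noLiteral : ∀ {ℓ} → ¬ In (lit ℓ)
    noLiteral {ℓ} iℓ =
      noSquare iℓ (clauseOnHole W̄) (clauseOnHole W) (complementOnHole W) (λ ()) (λ ())
        (toClause W) (litNeg≢ , complementNotAdjacent ℓ)
        (d′≢d , noEdge) (Ē-sym (toClause W̄))
      where
      open LiteralWedge
      W : LiteralWedge ℓ
      W = literalWedge iℓ
      W̄ : LiteralWedge (neg ℓ)
      W̄ = literalWedge (complementOnHole W)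
      d′≢d : cl (d W̄) ≢ cl (d W)
      d′≢d eq = complementMisses W (subst (Ē (lit (neg ℓ))) eq (toClause W̄))

    -- The Ḡ-neighbours of a clause vertex on the hole lie in C ∪ {b, z},
    -- which is a clique of Ḡ.
    data CliqueVertex : Vtx p q → Set where
      clause : ∀ d → CliqueVertex (cl d)
      cb     : CliqueVertex b
      cz     : CliqueVertex z

    cliqueNonEdge : ∀ {v w} → CliqueVertex v → CliqueVertex w → ¬ E v w
    cliqueNonEdge (clause _) (clause _) = noEdge
    cliqueNonEdge (clause _) cb         = noEdge
    cliqueNonEdge (clause _) cz         = noEdge
    cliqueNonEdge cb         (clause _) = noEdge
    cliqueNonEdge cb         cb         = noEdge
    cliqueNonEdge cb         cz         = noEdge
    cliqueNonEdge cz         (clause _) = noEdge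
    cliqueNonEdge cz         cb         = noEdge
    cliqueNonEdge cz         cz         = noEdge

    clauseCoNeighbour : ∀ {c w} → In w → Ē (cl c) w → CliqueVertex w
    clauseCoNeighbour {w = w} iw (_ , ¬cw) with view w
    ... | literal _   = ⊥-elim (noLiteral iw)
    ... | clause d    = clause d
    ... | pendant     = ⊥-elim (noA₁ iw)
    ... | special sa₂ = ⊥-elim (¬cw (inj₂ _))
    ... | special su₁ = ⊥-elim (¬cw (inj₂ _))
    ... | special su₂ = ⊥-elim (¬cw (inj₂ _))
    ... | special sb  = cb
    ... | special sy  = ⊥-elim (¬cw (inj₂ _))
    ... | special sz  = cz

    noClause : ∀ {c} → ¬ In (cl c)
    noClause ic with wedgeAt ic
    ... | wedge w₁ w₂ i₁ i₂ e₁ e₂ w₁≢w₂ ¬w₁w₂ =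
      ¬w₁w₂ (w₁≢w₂ , cliqueNonEdge (clauseCoNeighbour i₁ e₁) (clauseCoNeighbour i₂ e₂))

    specialOnly : ∀ {v} → In v → Special v
    specialOnly {v} iv with view v
    ... | literal _ = ⊥-elim (noLiteral iv)
    ... | clause _  = ⊥-elim (noClause iv)
    ... | pendant   = ⊥-elim (noA₁ iv)
    ... | special s = s

    -- A hole vertex adjacent in Ḡ to one of two partners on the hole is adjacent to
    -- the other, since partners have no further G-neighbours among special vertices.
    coNeighbourOfPartner : ∀ {w w′ x} → In w′ → In x → Partners w w′ → Ē w x → Ē w′ x
    coNeighbourOfPartner {w} iw′ ix P (w≢x , ¬wx) =
      (λ w′≡x → ¬wx (subst (E w) w′≡x (partnersEdge P))) ,
      (λ w′x → w≢x (partnerUnique (partnersSym P) (specialEdge (specialOnly iw′) (specialOnly ix) w′x)))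

    -- The ends w₁, w₂ of a wedge are partners, so the two Ḡ-neighbours of w₁
    -- are also Ḡ-neighbours of w₂: a square.
    impossible : ⊥
    impossible with vertex
    ... | v , iv with wedgeAt iv
    ...   | wedge w₁ w₂ i₁ i₂ _ _ w₁≢w₂ ¬w₁w₂ =
      ¬w₁w₂ (w₁≢w₂ , λ w₁w₂ → square (specialEdge (specialOnly i₁) (specialOnly i₂) w₁w₂))
      where
      square : Partners w₁ w₂ → ⊥
      square P with wedgeAt i₁
      ... | wedge x₁ x₂ j₁ j₂ f₁ f₂ x₁≢x₂ _ =
        noSquare i₁ i₂ j₁ j₂ w₁≢w₂ x₁≢x₂ f₁ f₂
          (coNeighbourOfPartner i₂ j₁ P f₁) (coNeighbourOfPartner i₂ j₂ P f₂)

-- Neither G nor its complement has an induced cycle on five or more vertices.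
proposition12 : (p q : ℕ) (cls : Fin q → Clause p) →
                (∀ c → Distinct3 (cls c)) →
                WeaklyChordal (G cls)
proposition12 p q cls _ =
  (λ m cycle → Construction.NoHole.impossible cls (holeOfCycle m cycle)) ,
  (λ m cycle → Construction.NoAntihole.impossible cls (holeOfCycle m cycle))
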